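{- Every class of finite graphs with bounded shrubdepth is set-defined.
   Context: SC-depth: $\mathcal{SC}_1=\{K_1\}$, and for $t>1$, $\mathcal{SC}_t$ is the class of graphs $G$ for which there exist graphs $G_1,\dots,G_k\in\mathcal{SC}_{t-1}$ on disjoint vertex sets and $A\subseteq V(G_1)\cup\dots\cup V(G_k)$ such that $G$ is obtained from the disjoint union of $G_1,\dots,G_k$ by complementing the adjacency of all pairs of distinct vertices in $A\times A$. A class has bounded shrubdepth iff it is contained in $\mathcal{SC}_t$ for some $t$. A class is set-defined if it is contained in the class of finite graphs isomorphic to finite induced subgraphs of a graph with vertex set $\mathbb N^k$ whose adjacency between distinct tuples $\bar a,\bar b$ is $\phi(\bar a,\bar b)\vee\phi(\bar b,\bar a)$ for some parameter-free first-order formula $\phi$ in the language of pure equality. -}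

module Defs where

open import Data.Nat using (ℕ; zero; suc; _+_)
open import Data.Fin using (Fin; splitAt; _≟_)
open import Data.Bool using (Bool; true; false; _∧_; _xor_; not)
open import Data.List using (List; []; _∷_; foldr)
open import Data.List.Relation.Unary.All using (All)
open import Data.Vec using (Vec; _∷_; lookup; _++_)
open import Data.Sum using (_⊎_; inj₁; inj₂)
open import Data.Product using (Σ; ∃; ∃-syntax; _×_; _,_)
open import Data.Empty using (⊥)
open import Data.Unit using (⊤)
open import Relation.Nullary using (¬_; does; yes; no)
open import Relation.Binary.PropositionalEquality using (_≡_; _≢_; refl; sym; cong)
open import Function.Bundles using (_↔_; _⇔_; Inverse)
open import Function.Definitions using (Injective)

record Graph : Set where
  field
    n      : ℕ
    adj    : Fin n → Fin n → Bool
    adjSym : ∀ u v → adj u v ≡ adj v u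
    adjIrr : ∀ u → adj u u ≡ false
open Graph public

_≅_ : Graph → Graph → Set
G ≅ H = Σ (Fin (n G) ↔ Fin (n H)) λ f →
          ∀ u v → adj G u v ≡ adj H (Inverse.to f u) (Inverse.to f v)

K₁ : Graph
K₁ = record { n = 1 ; adj = λ _ _ → false ; adjSym = λ _ _ → refl ; adjIrr = λ _ → refl }

emptyGraph : Graph
emptyGraph = record { n = 0 ; adj = λ () ; adjSym = λ () ; adjIrr = λ () }

private
  ⊕adj : ∀ {m k} → (Fin m → Fin m → Bool) → (Fin k → Fin k → Bool)
       → Fin m ⊎ Fin k → Fin m ⊎ Fin k → Bool
  ⊕adj a b (inj₁ x) (inj₁ y) = a x y
  ⊕adj a b (inj₂ x) (inj₂ y) = b x y
  ⊕adj a b (inj₁ x) (inj₂ y) = false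
  ⊕adj a b (inj₂ x) (inj₁ y) = false

  ⊕sym : ∀ {m k} (a : Fin m → Fin m → Bool) (b : Fin k → Fin k → Bool)
       → (∀ u v → a u v ≡ a v u) → (∀ u v → b u v ≡ b v u)
       → ∀ x y → ⊕adj a b x y ≡ ⊕adj a b y x
  ⊕sym a b sa sb (inj₁ x) (inj₁ y) = sa x y
  ⊕sym a b sa sb (inj₂ x) (inj₂ y) = sb x y
  ⊕sym a b sa sb (inj₁ x) (inj₂ y) = refl
  ⊕sym a b sa sb (inj₂ x) (inj₁ y) = refl

  ⊕irr : ∀ {m k} (a : Fin m → Fin m → Bool) (b : Fin k → Fin k → Bool)
       → (∀ u → a u u ≡ false) → (∀ u → b u u ≡ false)
       → ∀ x → ⊕adj a b x x ≡ false
  ⊕irr a b ia ib (inj₁ x) = ia x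
  ⊕irr a b ia ib (inj₂ x) = ib x

_⊕_ : Graph → Graph → Graph
G ⊕ H = record
  { n = n G + n H
  ; adj = λ u v → ⊕adj (adj G) (adj H) (splitAt (n G) u) (splitAt (n G) v)
  ; adjSym = λ u v → ⊕sym (adj G) (adj H) (adjSym G) (adjSym H) (splitAt (n G) u) (splitAt (n G) v)
  ; adjIrr = λ u → ⊕irr (adj G) (adj H) (adjIrr G) (adjIrr H) (splitAt (n G) u)
  }

⨁ : List Graph → Graph
⨁ = foldr _⊕_ emptyGraph

private
  inA : ∀ {m} → (Fin m → Bool) → Fin m → Fin m → Bool
  inA A u v = A u ∧ A v ∧ not (does (u ≟ v))

  ∧-comm' : ∀ a b → a ∧ b ≡ b ∧ a
  ∧-comm' false false = refl
  ∧-comm' false true = refl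
  ∧-comm' true false = refl
  ∧-comm' true true = refl

  ≟-sym : ∀ {m} (u v : Fin m) → does (u ≟ v) ≡ does (v ≟ u)
  ≟-sym u v with u ≟ v | v ≟ u
  ... | yes _ | yes _ = refl
  ... | no _  | no _  = refl
  ... | yes p | no q  with q (sym p)
  ... | ()
  ≟-sym u v | no p | yes q with p (sym q)
  ... | ()

  inA-sym : ∀ {m} (A : Fin m → Bool) u v → inA A u v ≡ inA A v u
  inA-sym A u v with A u | A v
  ... | false | false = refl
  ... | false | true  = refl
  ... | true  | false = refl
  ... | true  | true  = cong not (≟-sym u v)

  inA-irr : ∀ {m} (A : Fin m → Bool) u → inA A u u ≡ false
  inA-irr A u with u ≟ u
  ... | yes _ = ∧-comm' (A u) (A u ∧ false) ⟨trans⟩ lem (A u)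
    where
      _⟨trans⟩_ : ∀ {x y z : Bool} → x ≡ y → y ≡ z → x ≡ z
      refl ⟨trans⟩ q = q
      lem : ∀ a → (a ∧ false) ∧ a ≡ false
      lem false = refl
      lem true = refl
  ... | no ¬p with ¬p refl
  ... | ()

complementOn : (G : Graph) → (Fin (n G) → Bool) → Graph
complementOn G A = record
  { n = n G
  ; adj = λ u v → inA A u v xor adj G u v
  ; adjSym = λ u v → cong₂' (inA-sym A u v) (adjSym G u v)
  ; adjIrr = λ u → cong₂' (inA-irr A u) (adjIrr G u)
  }
  where
    cong₂' : ∀ {a b c d : Bool} → a ≡ b → c ≡ d → (a xor c) ≡ (b xor d)
    cong₂' refl refl = refl

data SC : ℕ → Graph → Set where
  sc-one  : ∀ {G} → G ≅ K₁ → SC 1 G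
  sc-step : ∀ {t G} (Gs : List Graph) → All (SC (suc t)) Gs
          → (A : Fin (n (⨁ Gs)) → Bool)
          → G ≅ complementOn (⨁ Gs) A
          → SC (suc (suc t)) G

GraphClass : Set₁
GraphClass = Graph → Set

BoundedShrubdepth : GraphClass → Set
BoundedShrubdepth C = ∃[ t ] (∀ G → C G → SC t G)

-- First-order formulas in the language of pure equality (no constants),
-- with m free variables (de Bruijn: variable zero is the innermost bound one)

data Formula : ℕ → Set where
  _≐_  : ∀ {m} → Fin m → Fin m → Formula m
  ⊤'   : ∀ {m} → Formula m
  ⊥'   : ∀ {m} → Formula m
  ¬'_  : ∀ {m} → Formula m → Formula m
  _∧'_ : ∀ {m} → Formula m → Formula m → Formula m
  _∨'_ : ∀ {m} → Formula m → Formula m → Formula m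
  _⇒'_ : ∀ {m} → Formula m → Formula m → Formula m
  ∃'   : ∀ {m} → Formula (suc m) → Formula m
  ∀'   : ∀ {m} → Formula (suc m) → Formula m

Sat : ∀ {m} → Formula m → Vec ℕ m → Set
Sat (x ≐ y)  ρ = lookup ρ x ≡ lookup ρ y
Sat ⊤'       ρ = ⊤
Sat ⊥'       ρ = ⊥
Sat (¬' φ)   ρ = ¬ Sat φ ρ
Sat (φ ∧' ψ) ρ = Sat φ ρ × Sat ψ ρ
Sat (φ ∨' ψ) ρ = Sat φ ρ ⊎ Sat ψ ρ
Sat (φ ⇒' ψ) ρ = Sat φ ρ → Sat ψ ρ
Sat (∃' φ)   ρ = Σ ℕ λ a → Sat φ (a ∷ ρ)
Sat (∀' φ)   ρ = (a : ℕ) → Sat φ (a ∷ ρ)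

DefAdj : ∀ k → Formula (k + k) → Vec ℕ k → Vec ℕ k → Set
DefAdj k φ a b = Sat φ (_++_ {n = k} a b) ⊎ Sat φ (_++_ {n = k} b a)

InducedIn : ∀ k → Formula (k + k) → Graph → Set
InducedIn k φ G =
  Σ (Fin (n G) → Vec ℕ k) λ f →
    Injective _≡_ _≡_ f ×
    (∀ u v → u ≢ v → (adj G u v ≡ true ⇔ DefAdj k φ (f u) (f v)))

SetDefined : GraphClass → Set
SetDefined C = ∃[ k ] Σ (Formula (k + k)) λ φ → ∀ G → C G → InducedIn k φ G

module Submission where

-- We show by induction on t that every graph of SC-depth t embeds into the
-- graph on ℕ^(2t) defined by one fixed equality formula Ψ t.  A vertex u of
-- G = complementOn (G₁ ⊕ … ⊕ G_k) A is sent to the tuple (c, m, x̄), where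
--   * c ∈ ℕ is the index of the part G_i containing u (its "colour"),
--   * m = c if u ∈ A and m = c + 1 otherwise, so that "u ∈ A" is the
--     equality c ≐ m, and
--   * x̄ is the tuple of u inside G_i given by the induction hypothesis.
-- Two distinct vertices are then adjacent iff
--   "both are marked"  xor  "same colour and Ψ (t - 1) holds of the x̄'s".

open import Defs
open import Data.Nat using (ℕ; zero; suc; _+_)
open import Data.Nat.Properties using (suc-injective; 1+n≢n; 0≢1+n)
open import Data.Fin using (Fin; zero; suc; splitAt; join; _↑ˡ_; _↑ʳ_; _≟_)
open import Data.Fin.Properties using (join-splitAt)
open import Data.Bool using (Bool; true; false; _∧_; _xor_)
open import Data.Bool.Properties using (∧-identityʳ)
open import Data.List.Relation.Unary.All using (All; []; _∷_)
open import Data.Vec using (Vec; _∷_; lookup; _++_; replicate)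
open import Data.Vec.Properties using (lookup-splitAt; lookup-++ˡ; lookup-++ʳ; ∷-injective)
open import Data.Sum using (_⊎_; inj₁; inj₂; [_,_]′)
open import Data.Sum.Function.Propositional using (_⊎-⇔_)
open import Data.Product using (_×_; _,_; proj₁; proj₂)
open import Data.Product.Function.NonDependent.Propositional using (_×-⇔_)
open import Data.Empty using (⊥-elim)
open import Relation.Nullary using (¬_; yes; no)
open import Relation.Nullary.Reflects using (Reflects; ofʸ; ofⁿ; _×-reflects_)
open import Relation.Binary.PropositionalEquality
open import Function.Bundles using (_⇔_; Equivalence; Inverse; Injection; mk⇔)
open import Function.Base using (_∘_)
open import Function.Definitions using (Injective)
open import Function.Construct.Identity using (⇔-id)
open import Function.Properties.Equivalence using () renaming (sym to ⇔-sym)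
open import Function.Properties.Inverse using (↔⇒↣)
open import Function.Related.TypeIsomorphisms using (→-cong-⇔; ¬-cong-⇔)

reflects-cong : ∀ {P Q : Set} {b} → P ⇔ Q → Reflects P b → Reflects Q b
reflects-cong P⇔Q (ofʸ p)  = ofʸ (Equivalence.to P⇔Q p)
reflects-cong P⇔Q (ofⁿ ¬p) = ofⁿ (λ q → ¬p (Equivalence.from P⇔Q q))

xor-reflects : ∀ {P Q : Set} {a b} → Reflects P a → Reflects Q b →
               Reflects ((P × ¬ Q) ⊎ (¬ P × Q)) (a xor b)
xor-reflects (ofʸ p)  (ofʸ q)  = ofⁿ λ { (inj₁ (_ , ¬q)) → ¬q q ; (inj₂ (¬p , _)) → ¬p p }
xor-reflects (ofʸ p)  (ofⁿ ¬q) = ofʸ (inj₁ (p , ¬q))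
xor-reflects (ofⁿ ¬p) (ofʸ q)  = ofʸ (inj₂ (¬p , q))
xor-reflects (ofⁿ ¬p) (ofⁿ ¬q) = ofⁿ λ { (inj₁ (p , _)) → ¬p p ; (inj₂ (_ , q)) → ¬q q }

reflects⇒≡true⇔ : ∀ {P : Set} {b} → Reflects P b → (b ≡ true ⇔ P)
reflects⇒≡true⇔ (ofʸ p)  = mk⇔ (λ _ → p) (λ _ → refl)
reflects⇒≡true⇔ (ofⁿ ¬p) = mk⇔ (λ ()) (λ p → ⊥-elim (¬p p))

≡-cong-⇔ : ∀ {A : Set} {x x′ y y′ : A} → x ≡ x′ → y ≡ y′ → (x ≡ y) ⇔ (x′ ≡ y′)
≡-cong-⇔ refl refl = ⇔-id _

lift : ∀ {m m′} → (Fin m → Fin m′) → Fin (suc m) → Fin (suc m′)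
lift r zero    = zero
lift r (suc i) = suc (r i)

rename : ∀ {m m′} → (Fin m → Fin m′) → Formula m → Formula m′
rename r (x ≐ y)  = r x ≐ r y
rename r ⊤'       = ⊤'
rename r ⊥'       = ⊥'
rename r (¬' φ)   = ¬' rename r φ
rename r (φ ∧' ψ) = rename r φ ∧' rename r ψ
rename r (φ ∨' ψ) = rename r φ ∨' rename r ψ
rename r (φ ⇒' ψ) = rename r φ ⇒' rename r ψ
rename r (∃' φ)   = ∃' (rename (lift r) φ)
rename r (∀' φ)   = ∀' (rename (lift r) φ)

Agrees : ∀ {m m′} → (Fin m → Fin m′) → Vec ℕ m′ → Vec ℕ m → Set
Agrees r ρ ρ′ = ∀ i → lookup ρ (r i) ≡ lookup ρ′ i

agrees-lift : ∀ {m m′} {r : Fin m → Fin m′} {ρ ρ′} a →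
              Agrees r ρ ρ′ → Agrees (lift r) (a ∷ ρ) (a ∷ ρ′)
agrees-lift a agree zero    = refl
agrees-lift a agree (suc i) = agree i

Sat-rename : ∀ {m m′} (r : Fin m → Fin m′) (φ : Formula m) {ρ ρ′} →
             Agrees r ρ ρ′ → Sat (rename r φ) ρ ⇔ Sat φ ρ′
Sat-rename r (x ≐ y)  agree = ≡-cong-⇔ (agree x) (agree y)
Sat-rename r ⊤'       agree = ⇔-id _
Sat-rename r ⊥'       agree = ⇔-id _
Sat-rename r (¬' φ)   agree = ¬-cong-⇔ (Sat-rename r φ agree)
Sat-rename r (φ ∧' ψ) agree = Sat-rename r φ agree ×-⇔ Sat-rename r ψ agree
Sat-rename r (φ ∨' ψ) agree = Sat-rename r φ agree ⊎-⇔ Sat-rename r ψ agree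
Sat-rename r (φ ⇒' ψ) agree = →-cong-⇔ (Sat-rename r φ agree) (Sat-rename r ψ agree)
Sat-rename r (∃' φ)   agree = mk⇔
  (λ { (a , s) → a , Equivalence.to   (Sat-rename (lift r) φ (agrees-lift a agree)) s })
  (λ { (a , s) → a , Equivalence.from (Sat-rename (lift r) φ (agrees-lift a agree)) s })
Sat-rename r (∀' φ)   agree = mk⇔
  (λ s a → Equivalence.to   (Sat-rename (lift r) φ (agrees-lift a agree)) (s a))
  (λ s a → Equivalence.from (Sat-rename (lift r) φ (agrees-lift a agree)) (s a))

_xor'_ : ∀ {m} → Formula m → Formula m → Formula m
φ xor' ψ = (φ ∧' (¬' ψ)) ∨' ((¬' φ) ∧' ψ)

record Realization (k : ℕ) (ψ : Formula (k + k)) (G : Graph) : Set where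
  field
    point     : Fin (n G) → Vec ℕ k
    injective : Injective _≡_ _≡_ point
    reflects  : ∀ u v → u ≢ v → Reflects (Sat ψ (point u ++ point v)) (adj G u v)

-- A realization of a disjoint union: vertices additionally carry a colour
-- (their component), the map is injective on (colour, point), and vertices
-- are adjacent iff they have the same colour and satisfy ψ.
record ColouredRealization (k : ℕ) (ψ : Formula (k + k)) (G : Graph) : Set where
  field
    colour    : Fin (n G) → ℕ
    point     : Fin (n G) → Vec ℕ k
    injective : ∀ u v → colour u ≡ colour v → point u ≡ point v → u ≡ v
    reflects  : ∀ u v → u ≢ v →
                Reflects (colour u ≡ colour v × Sat ψ (point u ++ point v)) (adj G u v)

-- Since ψ only has to hold in one direction for DefAdj, a realization yields
-- an induced embedding into the graph defined by ψ.
realization⇒inducedIn : ∀ {k ψ G} → Realization k ψ G → InducedIn k ψ G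
realization⇒inducedIn {G = G} R = point , injective , adjacent
  where
    open Realization R
    adjacent : ∀ u v → u ≢ v → adj G u v ≡ true ⇔ DefAdj _ _ (point u) (point v)
    adjacent u v u≢v = mk⇔
      (λ uv → inj₁ (Equivalence.to (reflects⇒≡true⇔ (reflects u v u≢v)) uv))
      λ { (inj₁ s) → Equivalence.from (reflects⇒≡true⇔ (reflects u v u≢v)) s
        ; (inj₂ s) → trans (adjSym G u v)
                       (Equivalence.from (reflects⇒≡true⇔ (reflects v u (u≢v ∘ sym))) s) }

realization-≅ : ∀ {k ψ G H} → G ≅ H → Realization k ψ H → Realization k ψ G
realization-≅ {G = G} {H} (I , adj≡) R = record
  { point     = λ u → point (to u)
  ; injective = λ eq → to-injective (injective eq)
  ; reflects  = λ u v u≢v →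
      subst (Reflects _) (sym (adj≡ u v)) (reflects (to u) (to v) (u≢v ∘ to-injective))
  }
  where
    open Realization R
    open Inverse I using (to)
    to-injective : Injective _≡_ _≡_ to
    to-injective = Injection.injective (↔⇒↣ I)

realization-K₁ : ∀ {k ψ G} → G ≅ K₁ → Realization k ψ G
realization-K₁ {G = G} (I , _) = record
  { point     = λ _ → replicate _ 0
  ; injective = λ _ → single _ _
  ; reflects  = λ u v u≢v → ⊥-elim (u≢v (single u v))
  }
  where
    unique : (x y : Fin 1) → x ≡ y
    unique zero zero = refl
    single : (u v : Fin (n G)) → u ≡ v
    single u v = Injection.injective (↔⇒↣ I) (unique (Inverse.to I u) (Inverse.to I v))

splitAt-injective : ∀ m {k} {u v : Fin (m + k)} → splitAt m u ≡ splitAt m v → u ≡ v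
splitAt-injective m {k} {u} {v} eq = begin
  u                      ≡⟨ join-splitAt m k u ⟨
  join m k (splitAt m u) ≡⟨ cong (join m k) eq ⟩
  join m k (splitAt m v) ≡⟨ join-splitAt m k v ⟩
  v                      ∎
  where open ≡-Reasoning

splitAt-≢ : ∀ m {k} {u v : Fin (m + k)} {s s′} →
            splitAt m u ≡ s → splitAt m v ≡ s′ → u ≢ v → s ≢ s′
splitAt-≢ m refl refl u≢v = u≢v ∘ splitAt-injective m

coloured-empty : ∀ {k ψ} → ColouredRealization k ψ emptyGraph
coloured-empty = record { colour = λ () ; point = λ () ; injective = λ () ; reflects = λ () }

coloured-⊕ : ∀ {k ψ H R} → Realization k ψ H → ColouredRealization k ψ R →
             ColouredRealization k ψ (H ⊕ R)
coloured-⊕ {k} {ψ} {H} {R} RH RR = record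
  { colour    = colourₛ ∘ splitAt (n H)
  ; point     = pointₛ ∘ splitAt (n H)
  ; injective = λ u v c≡ p≡ → splitAt-injective (n H) (injectiveₛ _ _ c≡ p≡)
  ; reflects  = reflects
  }
  where
    module H = Realization RH
    module R = ColouredRealization RR

    colourₛ : Fin (n H) ⊎ Fin (n R) → ℕ
    colourₛ (inj₁ _) = 0
    colourₛ (inj₂ y) = suc (R.colour y)

    pointₛ : Fin (n H) ⊎ Fin (n R) → Vec ℕ k
    pointₛ (inj₁ x) = H.point x
    pointₛ (inj₂ y) = R.point y

    injectiveₛ : ∀ s s′ → colourₛ s ≡ colourₛ s′ → pointₛ s ≡ pointₛ s′ → s ≡ s′
    injectiveₛ (inj₁ x) (inj₁ y) _   p≡ = cong inj₁ (H.injective p≡)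
    injectiveₛ (inj₂ x) (inj₂ y) c≡ p≡ = cong inj₂ (R.injective x y (suc-injective c≡) p≡)
    injectiveₛ (inj₁ x) (inj₂ y) () _
    injectiveₛ (inj₂ x) (inj₁ y) () _

    suc-≡-⇔ : ∀ {a b} → (suc a ≡ suc b) ⇔ (a ≡ b)
    suc-≡-⇔ = mk⇔ suc-injective (cong suc)

    reflects : ∀ u v → u ≢ v →
               Reflects (colourₛ (splitAt (n H) u) ≡ colourₛ (splitAt (n H) v)
                         × Sat ψ (pointₛ (splitAt (n H) u) ++ pointₛ (splitAt (n H) v)))
                        (adj (H ⊕ R) u v)
    reflects u v u≢v with splitAt (n H) u in eu | splitAt (n H) v in ev
    ... | inj₁ x | inj₁ y = reflects-cong (mk⇔ (refl ,_) proj₂)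
                              (H.reflects x y (splitAt-≢ (n H) eu ev u≢v ∘ cong inj₁))
    ... | inj₂ x | inj₂ y = reflects-cong (⇔-sym suc-≡-⇔ ×-⇔ ⇔-id _)
                              (R.reflects x y (splitAt-≢ (n H) eu ev u≢v ∘ cong inj₂))
    ... | inj₁ x | inj₂ y = ofⁿ (0≢1+n ∘ proj₁)
    ... | inj₂ x | inj₁ y = ofⁿ (0≢1+n ∘ sym ∘ proj₁)

coloured-⨁ : ∀ {k ψ Gs} → All (Realization k ψ) Gs → ColouredRealization k ψ (⨁ Gs)
coloured-⨁ []       = coloured-empty
coloured-⨁ (R ∷ Rs) = coloured-⊕ R (coloured-⨁ Rs)

complementOn-adj : ∀ G (A : Fin (n G) → Bool) u v → u ≢ v →
                   adj (complementOn G A) u v ≡ (A u ∧ A v) xor adj G u v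
complementOn-adj G A u v u≢v with u ≟ v
... | yes u≡v = ⊥-elim (u≢v u≡v)
... | no _    = cong (λ b → (A u ∧ b) xor adj G u v) (∧-identityʳ (A v))

-- A Boolean b is stored next to a number c as c itself (true) or c + 1
-- (false), so that it can be read off by an equality test.
mark : Bool → ℕ → ℕ
mark true  c = c
mark false c = suc c

mark-reflects : ∀ b c → Reflects (c ≡ mark b c) b
mark-reflects true  c = ofʸ refl
mark-reflects false c = ofⁿ (1+n≢n ∘ sym)

-- Given the formula ψ on ℕ^k realizing the parts, the formula φ on ℕ^(2+k)
-- realizing the complemented union.  Variables of φ are (cₓ, mₓ, x̄, c_y, m_y, ȳ).
module ComplementStep (k : ℕ) (ψ : Formula (k + k)) where

  M : ℕ
  M = 2 + k

  colourₓ markₓ colourᵧ markᵧ : Fin (M + M)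
  colourₓ = zero
  markₓ   = suc zero
  colourᵧ = M ↑ʳ zero
  markᵧ   = M ↑ʳ suc zero

  embedVar′ : Fin k ⊎ Fin k → Fin (M + M)
  embedVar′ (inj₁ i) = suc (suc (i ↑ˡ M))
  embedVar′ (inj₂ j) = M ↑ʳ suc (suc j)

  embedVar : Fin (k + k) → Fin (M + M)
  embedVar = embedVar′ ∘ splitAt k

  bothMarked sameComponent φ : Formula (M + M)
  bothMarked    = (colourₓ ≐ markₓ) ∧' (colourᵧ ≐ markᵧ)
  sameComponent = (colourₓ ≐ colourᵧ) ∧' rename embedVar ψ
  φ             = bothMarked xor' sameComponent

  module _ (c m c′ m′ : ℕ) (xs ys : Vec ℕ k) where
    ρ : Vec ℕ (M + M)
    ρ = (c ∷ m ∷ xs) ++ (c′ ∷ m′ ∷ ys)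

    private
      lookup-right : ∀ i → lookup ρ (M ↑ʳ i) ≡ lookup (c′ ∷ m′ ∷ ys) i
      lookup-right = lookup-++ʳ (c ∷ m ∷ xs) (c′ ∷ m′ ∷ ys)

      agrees′ : ∀ s → lookup ρ (embedVar′ s) ≡ [ lookup xs , lookup ys ]′ s
      agrees′ (inj₁ i) = lookup-++ˡ xs (c′ ∷ m′ ∷ ys) i
      agrees′ (inj₂ j) = lookup-right (suc (suc j))

      agrees : Agrees embedVar ρ (xs ++ ys)
      agrees i = trans (agrees′ (splitAt k i)) (sym (lookup-splitAt k xs ys i))

    bothMarked-⇔ : Sat bothMarked ρ ⇔ (c ≡ m × c′ ≡ m′)
    bothMarked-⇔ = ⇔-id _ ×-⇔ ≡-cong-⇔ (lookup-right zero) (lookup-right (suc zero))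

    sameComponent-⇔ : Sat sameComponent ρ ⇔ (c ≡ c′ × Sat ψ (xs ++ ys))
    sameComponent-⇔ = ≡-cong-⇔ refl (lookup-right zero) ×-⇔ Sat-rename embedVar ψ agrees

  complement-realization : ∀ {H} (A : Fin (n H) → Bool) →
                           ColouredRealization k ψ H → Realization M φ (complementOn H A)
  complement-realization {H} A CR = record
    { point     = point′
    ; injective = injective′
    ; reflects  = reflects′
    }
    where
      open ColouredRealization CR

      point′ : Fin (n H) → Vec ℕ M
      point′ u = colour u ∷ mark (A u) (colour u) ∷ point u

      injective′ : Injective _≡_ _≡_ point′
      injective′ {u} {v} eq with ∷-injective eq
      ... | c≡ , rest = injective u v c≡ (proj₂ (∷-injective rest))

      reflects′ : ∀ u v → u ≢ v →
                  Reflects (Sat φ (point′ u ++ point′ v)) (adj (complementOn H A) u v)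
      reflects′ u v u≢v = subst (Reflects _) (sym (complementOn-adj H A u v u≢v))
        (xor-reflects
          (reflects-cong (⇔-sym (bothMarked-⇔ _ _ _ _ (point u) (point v)))
                         (mark-reflects (A u) _ ×-reflects mark-reflects (A v) _))
          (reflects-cong (⇔-sym (sameComponent-⇔ _ _ _ _ (point u) (point v)))
                         (reflects u v u≢v)))

-- Dimension and formula realizing SC-depth t (for t ≥ 1; K₁ is realized by
-- any formula, so the base formula is arbitrary).
dimension : ℕ → ℕ
dimension zero    = 0
dimension (suc t) = 2 + dimension t

Ψ : (t : ℕ) → Formula (dimension t + dimension t)
Ψ zero    = ⊥'
Ψ (suc t) = ComplementStep.φ (dimension t) (Ψ t)

realize    : ∀ {t G} → SC t G → Realization (dimension t) (Ψ t) G
realizeAll : ∀ {t Gs} → All (SC t) Gs → All (Realization (dimension t) (Ψ t)) Gs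

realize (sc-one G≅K₁) = realization-K₁ G≅K₁
realize (sc-step Gs parts A G≅) =
  realization-≅ G≅ (ComplementStep.complement-realization _ _ A (coloured-⨁ (realizeAll parts)))

realizeAll []       = []
realizeAll (p ∷ ps) = realize p ∷ realizeAll ps

mainTheorem15 : (C : GraphClass) → BoundedShrubdepth C → SetDefined C
mainTheorem15 C (t , C⊆SCₜ) =
  dimension t , Ψ t , λ G G∈C → realization⇒inducedIn (realize (C⊆SCₜ G G∈C))
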